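{- For any positive integers $k,n$ with $2\le k\le n-1$, $$(-1)^{k}(k+1)\eta_{2,k}\eta_{k+2,n}+\sum_{i=k+1}^{n-1}(-1)^{i}\big[(k+1)\eta_{2,k-1}\sqcup\!\sqcup \delta_{i,k+2}\big]k\sqcup\!\sqcup\eta_{i+1,n}=(-1)^{n+1}\big[(k+1)\eta_{2,k-1}\sqcup\!\sqcup \delta_{n,k+2}\big]k.$$
   Context: Identities take place in the $\Bbbk$-vector space with basis all finite words over the positive integers ($\Bbbk$ a field of characteristic zero), with empty word $\emptyset$. Concatenation is extended bilinearly and binds more tightly than shuffle; $(k+1)$ and $k$ denote single letters, and $[u\sqcup\!\sqcup v]c$ means each term of $u\sqcup\!\sqcup v$ concatenated with the letter $c$. The shuffle product $\sqcup\!\sqcup$ is the bilinear product with $\emptyset$ as unit and $au\sqcup\!\sqcup bv=a(u\sqcup\!\sqcup bv)+b(au\sqcup\!\sqcup v)$ for letters $a,b$ and words $u,v$. For integers $k,l$: $\eta_{k,l}=k(k+1)\cdots l$ if $k\le l$, $\emptyset$ if $k=l+1$, and $0$ (zero vector) if $k\ge l+2$; $\delta_{l,k}=l(l-1)\cdots k$ if $k\le l$, $\emptyset$ if $k=l+1$, and $0$ if $k\ge l+2$. An empty sum is $0$. -}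

module Defs where

open import Data.Nat using (ℕ; zero; suc; _≤?_; _∸_)
open import Data.Integer using (ℤ; +_; -_; _*_; _+_)
open import Data.List using (List; []; _∷_; map; _++_; concatMap; reverse)
open import Data.List.Properties using (≡-dec)
open import Data.Nat.Properties using (_≟_)
open import Data.Product using (_×_; _,_)
open import Relation.Nullary using (yes; no)
open import Relation.Binary.PropositionalEquality using (_≡_)

-- Words over the positive integers (letters are natural numbers; all
-- letters occurring in the statement are ≥ 2).
Word : Set
Word = List ℕ

-- Finite formal ℤ-linear combinations of words (a term list; equality
-- is up to the coefficient-wise relation _≈_ below).
Lin : Set
Lin = List (ℤ × Word)

coeff : Word → Lin → ℤ
coeff w [] = + 0
coeff w ((c , u) ∷ xs) with ≡-dec _≟_ u w
... | yes _ = c + coeff w xs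
... | no  _ = coeff w xs

_≈_ : Lin → Lin → Set
x ≈ y = ∀ (w : Word) → coeff w x ≡ coeff w y

infix 4 _≈_

⟦_⟧ : Word → Lin
⟦ w ⟧ = (+ 1 , w) ∷ []

_⊕_ : Lin → Lin → Lin
x ⊕ y = x ++ y

infixl 5 _⊕_

_·_ : ℤ → Lin → Lin
c · x = map (λ { (d , u) → (c * d , u) }) x

_⋆_ : Lin → Lin → Lin
x ⋆ y = concatMap (λ { (c , u) → map (λ { (d , v) → (c * d , u ++ v) }) y }) x

infixl 7 _⋆_

shw : Word → Word → Lin
shw [] v = ⟦ v ⟧
shw (a ∷ u) [] = ⟦ a ∷ u ⟧
shw (a ∷ u) (b ∷ v) =
  map (λ { (c , w) → (c , a ∷ w) }) (shw u (b ∷ v)) ++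
  map (λ { (c , w) → (c , b ∷ w) }) (shw (a ∷ u) v)

_⧢_ : Lin → Lin → Lin
x ⧢ y = concatMap (λ { (c , u) → concatMap (λ { (d , v) → (c * d) · shw u v }) y }) x

infixl 6 _⧢_

ltr : ℕ → Lin
ltr a = ⟦ a ∷ [] ⟧

upFrom : ℕ → ℕ → Word
upFrom k zero = []
upFrom k (suc m) = k ∷ upFrom (suc k) m

-- η_{k,l} = k(k+1)...l if k ≤ l, ∅ if k = l+1, 0 if k ≥ l+2
η : ℕ → ℕ → Lin
η k l with k ≤? suc l
... | yes _ = ⟦ upFrom k (suc l ∸ k) ⟧
... | no  _ = []

-- δ_{l,k} = l(l-1)...k if k ≤ l, ∅ if k = l+1, 0 if k ≥ l+2
δ : ℕ → ℕ → Lin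
δ l k with k ≤? suc l
... | yes _ = ⟦ reverse (upFrom k (suc l ∸ k)) ⟧
... | no  _ = []

sgn : ℕ → ℤ
sgn zero = + 1
sgn (suc i) = - sgn i

-- Σ_{i=a}^{b} f i  (empty sum = 0 when b < a)
Σ[_⋯_] : ℕ → ℕ → (ℕ → Lin) → Lin
Σ[ a ⋯ b ] f = concatMap f (upFrom a (suc b ∸ a))

{-# OPTIONS --safe #-}
-- The identity holds with (k+1)η_{2,k-1} replaced by any vector X and the final letter k by any
-- letter a, and is proved by induction on n ≥ k+1, the case n = k+1 being trivial.  Passing from
-- n to N = n+1 appends the letter N to every η, and the last-letter form of the shuffle recursion,
--   ua ⧢ vN = (u ⧢ vN) a + (ua ⧢ v) N,
-- splits the new left side into words ending in N and words ending in a.  The former add up to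
-- (difference of the two sides for n) N = 0.  By associativity of ⧢ the latter add up to
-- [X ⧢ Σ_{i=k+1}^{n} (-1)^i δ_{i,k+2} ⧢ η_{i+1,N}] a, and the antipode identity of the shuffle
-- algebra for the word (k+2) ⋯ N turns this sum into (-1)^{N+1} δ_{N,k+2}.
module Submission where

open import Defs
open import Algebra.Bundles using (CommutativeMonoid)
import Algebra.Properties.CommutativeSemigroup as CommutativeSemigroupProperties
open import Data.Empty using (⊥-elim)
open import Data.Integer as ℤ using (ℤ; +_; -_; -1ℤ)
import Data.Integer.Properties as ℤ
open import Data.Integer.Solver using (module +-*-Solver)
open import Data.List using ([]; _∷_; _++_; map; concatMap; reverse; length)
import Data.List.Properties as List
open import Data.List.Properties using (≡-dec)
open import Data.Nat using (ℕ; zero; suc; _+_; _∸_; _≤_; _<_; z≤n; s≤s; _≤?_)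
import Data.Nat.Properties as ℕ
open import Data.Nat.Properties using (_≟_)
open import Data.Product using (_,_)
open import Data.Sum using (inj₁; inj₂)
open import Relation.Binary.Bundles using (Setoid)
open import Relation.Binary.PropositionalEquality
  using (_≡_; refl; sym; trans; cong; cong₂; subst; module ≡-Reasoning)
import Relation.Binary.Reasoning.Setoid as SetoidReasoning
open import Relation.Nullary using (yes; no; ¬_)

coeff-++ : ∀ w x y → coeff w (x ++ y) ≡ coeff w x ℤ.+ coeff w y
coeff-++ w []            y = sym (ℤ.+-identityˡ _)
coeff-++ w ((c , u) ∷ x) y with ≡-dec _≟_ u w
... | yes _ = trans (cong (λ z → c ℤ.+ z) (coeff-++ w x y)) (sym (ℤ.+-assoc c _ _))
... | no  _ = coeff-++ w x y

coeff-· : ∀ w c x → coeff w (c · x) ≡ c ℤ.* coeff w x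
coeff-· w c []            = sym (ℤ.*-zeroʳ c)
coeff-· w c ((d , u) ∷ x) with ≡-dec _≟_ u w
... | yes _ = trans (cong (λ z → c ℤ.* d ℤ.+ z) (coeff-· w c x)) (sym (ℤ.*-distribˡ-+ c d _))
... | no  _ = coeff-· w c x

-- _≈_ wrapped in a record, so that the two vectors can be inferred from a proof.
infix 4 _≋_
record _≋_ (x y : Lin) : Set where
  constructor mk≋
  field ≋⇒≈ : x ≈ y
open _≋_ public

≋-refl : ∀ {x} → x ≋ x
≋-refl = mk≋ λ _ → refl

≋-sym : ∀ {x y} → x ≋ y → y ≋ x
≋-sym (mk≋ p) = mk≋ λ w → sym (p w)

≋-trans : ∀ {x y z} → x ≋ y → y ≋ z → x ≋ z
≋-trans (mk≋ p) (mk≋ q) = mk≋ λ w → trans (p w) (q w)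

≡⇒≋ : ∀ {x y} → x ≡ y → x ≋ y
≡⇒≋ refl = ≋-refl

≋-setoid : Setoid _ _
≋-setoid = record
  { Carrier = Lin ; _≈_ = _≋_
  ; isEquivalence = record { refl = ≋-refl ; sym = ≋-sym ; trans = ≋-trans } }

⊕-cong : ∀ {x x′ y y′} → x ≋ x′ → y ≋ y′ → x ⊕ y ≋ x′ ⊕ y′
⊕-cong {x} {x′} {y} {y′} (mk≋ p) (mk≋ q) = mk≋ λ w →
  trans (coeff-++ w x y) (trans (cong₂ ℤ._+_ (p w) (q w)) (sym (coeff-++ w x′ y′)))

⊕-comm : ∀ x y → x ⊕ y ≋ y ⊕ x
⊕-comm x y = mk≋ λ w →
  trans (coeff-++ w x y) (trans (ℤ.+-comm (coeff w x) _) (sym (coeff-++ w y x)))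

⊕-commutativeMonoid : CommutativeMonoid _ _
⊕-commutativeMonoid = record
  { Carrier = Lin ; _≈_ = _≋_ ; _∙_ = _⊕_ ; ε = []
  ; isCommutativeMonoid = record
    { isMonoid = record
      { isSemigroup = record
        { isMagma = record
          { isEquivalence = Setoid.isEquivalence ≋-setoid ; ∙-cong = ⊕-cong }
        ; assoc = λ x y z → ≡⇒≋ (List.++-assoc x y z) }
      ; identity = (λ _ → ≋-refl) , (λ x → ≡⇒≋ (List.++-identityʳ x)) }
    ; comm = ⊕-comm } }

open CommutativeMonoid ⊕-commutativeMonoid public
  using () renaming (∙-congˡ to ⊕-congˡ; ∙-congʳ to ⊕-congʳ; identityʳ to ⊕-identityʳ; assoc to ⊕-assoc)
open CommutativeSemigroupProperties
  (CommutativeMonoid.commutativeSemigroup ⊕-commutativeMonoid) public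
  using (interchange; x∙yz≈y∙xz)

·-cong : ∀ c {x y} → x ≋ y → c · x ≋ c · y
·-cong c {x} {y} (mk≋ p) = mk≋ λ w →
  trans (coeff-· w c x) (trans (cong (c ℤ.*_) (p w)) (sym (coeff-· w c y)))

·-distribˡ-⊕ : ∀ c x y → c · (x ⊕ y) ≋ c · x ⊕ c · y
·-distribˡ-⊕ c x y = ≡⇒≋ (List.map-++ _ x y)

·-assoc : ∀ c d x → c · (d · x) ≋ (c ℤ.* d) · x
·-assoc c d x = mk≋ λ w → trans (coeff-· w c (d · x))
  (trans (cong (c ℤ.*_) (coeff-· w d x)) (trans (sym (ℤ.*-assoc c d _)) (sym (coeff-· w (c ℤ.* d) x))))

·-identityˡ : ∀ x → (+ 1) · x ≋ x
·-identityˡ x = mk≋ λ w → trans (coeff-· w (+ 1) x) (ℤ.*-identityˡ (coeff w x))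

·-inverseˡ : ∀ c x → (- c) · x ⊕ c · x ≋ []
·-inverseˡ c x = mk≋ λ w → begin
  coeff w ((- c) · x ⊕ c · x)                  ≡⟨ coeff-++ w ((- c) · x) (c · x) ⟩
  coeff w ((- c) · x) ℤ.+ coeff w (c · x)      ≡⟨ cong₂ ℤ._+_ (coeff-· w (- c) x) (coeff-· w c x) ⟩
  (- c) ℤ.* coeff w x ℤ.+ c ℤ.* coeff w x      ≡⟨ ℤ.*-distribʳ-+ (coeff w x) (- c) c ⟨
  (- c ℤ.+ c) ℤ.* coeff w x                    ≡⟨ cong (ℤ._* coeff w x) (ℤ.+-inverseˡ c) ⟩
  + 0 ℤ.* coeff w x                            ≡⟨ ℤ.*-zeroˡ (coeff w x) ⟩
  + 0                                          ∎
  where open ≡-Reasoning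

x⊕c·y≋[]⇒x≋-c·y : ∀ x c y → x ⊕ c · y ≋ [] → x ≋ (- c) · y
x⊕c·y≋[]⇒x≋-c·y x c y (mk≋ x+cy≈0) = mk≋ λ w → begin
  coeff w x
    ≡⟨ solve 3 (λ x c y → x := (x :+ c :* y) :+ (:- c) :* y) refl (coeff w x) c (coeff w y) ⟩
  (coeff w x ℤ.+ c ℤ.* coeff w y) ℤ.+ - c ℤ.* coeff w y
    ≡⟨ cong₂ ℤ._+_ (cong (λ z → coeff w x ℤ.+ z) (coeff-· w c y)) (coeff-· w (- c) y) ⟨
  (coeff w x ℤ.+ coeff w (c · y)) ℤ.+ coeff w ((- c) · y)
    ≡⟨ cong (ℤ._+ coeff w ((- c) · y)) (trans (sym (coeff-++ w x (c · y))) (x+cy≈0 w)) ⟩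
  + 0 ℤ.+ coeff w ((- c) · y)
    ≡⟨ ℤ.+-identityˡ _ ⟩
  coeff w ((- c) · y) ∎
  where
  open ≡-Reasoning
  open +-*-Solver

lin : (Word → Lin) → Lin → Lin
lin f []            = []
lin f ((c , u) ∷ x) = c · f u ⊕ lin f x

linℤ : (Word → ℤ) → Lin → ℤ
linℤ g []            = + 0
linℤ g ((c , u) ∷ x) = c ℤ.* g u ℤ.+ linℤ g x

coeff-lin : ∀ w f x → coeff w (lin f x) ≡ linℤ (λ u → coeff w (f u)) x
coeff-lin w f []            = refl
coeff-lin w f ((c , u) ∷ x) =
  trans (coeff-++ w (c · f u) (lin f x)) (cong₂ ℤ._+_ (coeff-· w c (f u)) (coeff-lin w f x))

linℤ-++ : ∀ g x y → linℤ g (x ++ y) ≡ linℤ g x ℤ.+ linℤ g y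
linℤ-++ g []            y = sym (ℤ.+-identityˡ _)
linℤ-++ g ((c , u) ∷ x) y =
  trans (cong (λ z → c ℤ.* g u ℤ.+ z) (linℤ-++ g x y)) (sym (ℤ.+-assoc (c ℤ.* g u) _ _))

linℤ-· : ∀ g d x → linℤ g (d · x) ≡ d ℤ.* linℤ g x
linℤ-· g d []            = sym (ℤ.*-zeroʳ d)
linℤ-· g d ((c , u) ∷ x) =
  trans (cong₂ ℤ._+_ (ℤ.*-assoc d c (g u)) (linℤ-· g d x)) (sym (ℤ.*-distribˡ-+ d _ _))

remove : Word → Lin → Lin
remove u []            = []
remove u ((d , v) ∷ x) with ≡-dec _≟_ v u
... | yes _ = remove u x
... | no  _ = (d , v) ∷ remove u x

linℤ-remove : ∀ g u x → linℤ g x ≡ coeff u x ℤ.* g u ℤ.+ linℤ g (remove u x)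
linℤ-remove g u []            = sym (ℤ.*-zeroˡ (g u))
linℤ-remove g u ((d , v) ∷ x) with ≡-dec _≟_ v u
... | yes refl = trans (cong (λ z → d ℤ.* g v ℤ.+ z) (linℤ-remove g v x))
  (solve 4 (λ d e g r → d :* g :+ (e :* g :+ r) := (d :+ e) :* g :+ r) refl d (coeff v x) (g v) _)
  where open +-*-Solver
... | no _ = trans (cong (λ z → d ℤ.* g v ℤ.+ z) (linℤ-remove g u x))
  (solve 3 (λ a b r → a :+ (b :+ r) := b :+ (a :+ r)) refl (d ℤ.* g v) (coeff u x ℤ.* g u) _)
  where open +-*-Solver

coeff-remove-≡ : ∀ u x → coeff u (remove u x) ≡ + 0
coeff-remove-≡ u []            = refl
coeff-remove-≡ u ((d , v) ∷ x) with ≡-dec _≟_ v u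
... | yes _   = coeff-remove-≡ u x
... | no  v≢u with ≡-dec _≟_ v u
...   | yes v≡u = ⊥-elim (v≢u v≡u)
...   | no  _   = coeff-remove-≡ u x

coeff-remove-≢ : ∀ {u w} x → ¬ u ≡ w → coeff w (remove u x) ≡ coeff w x
coeff-remove-≢ []                  u≢w = refl
coeff-remove-≢ {u} {w} ((d , v) ∷ x) u≢w with ≡-dec _≟_ v u
... | yes refl with ≡-dec _≟_ v w
...   | yes v≡w = ⊥-elim (u≢w v≡w)
...   | no  _   = coeff-remove-≢ x u≢w
coeff-remove-≢ {u} {w} ((d , v) ∷ x) u≢w | no _ with ≡-dec _≟_ v w
...   | yes _ = cong (λ z → d ℤ.+ z) (coeff-remove-≢ x u≢w)
...   | no  _ = coeff-remove-≢ x u≢w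

remove-≋[] : ∀ u {x} → x ≋ [] → remove u x ≋ []
remove-≋[] u {x} (mk≋ x≈0) = mk≋ λ w → case u w
  where
  case : ∀ u w → coeff w (remove u x) ≡ + 0
  case u w with ≡-dec _≟_ u w
  ... | yes refl = coeff-remove-≡ u x
  ... | no  u≢w  = trans (coeff-remove-≢ x u≢w) (x≈0 w)

length-remove : ∀ u x → length (remove u x) ≤ length x
length-remove u []            = ℕ.≤-refl
length-remove u ((d , v) ∷ x) with ≡-dec _≟_ v u
... | yes _ = ℕ.m≤n⇒m≤1+n (length-remove u x)
... | no  _ = s≤s (length-remove u x)

length-remove-head : ∀ d u x → length (remove u ((d , u) ∷ x)) < length ((d , u) ∷ x)
length-remove-head d u x with ≡-dec _≟_ u u
... | yes _   = s≤s (length-remove u x)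
... | no  u≢u = ⊥-elim (u≢u refl)

-- Each step removes every occurrence of one word, whose total coefficient is 0.
linℤ-≋[] : ∀ g {x} → x ≋ [] → linℤ g x ≡ + 0
linℤ-≋[] g {x} = go (length x) x ℕ.≤-refl
  where
  go : ∀ n x → length x ≤ n → x ≋ [] → linℤ g x ≡ + 0
  go n       []            _ _   = refl
  go (suc n) ((d , u) ∷ x) (s≤s len) x≈0 = begin
    linℤ g ((d , u) ∷ x)
      ≡⟨ linℤ-remove g u ((d , u) ∷ x) ⟩
    coeff u ((d , u) ∷ x) ℤ.* g u ℤ.+ linℤ g (remove u ((d , u) ∷ x))
      ≡⟨ cong₂ ℤ._+_ (cong (ℤ._* g u) (≋⇒≈ x≈0 u)) rest ⟩
    + 0 ℤ.* g u ℤ.+ + 0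
      ≡⟨ cong (ℤ._+ + 0) (ℤ.*-zeroˡ (g u)) ⟩
    + 0 ∎
    where
    open ≡-Reasoning
    rest : linℤ g (remove u ((d , u) ∷ x)) ≡ + 0
    rest = go n _ (ℕ.≤-pred (ℕ.≤-trans (length-remove-head d u x) (s≤s len))) (remove-≋[] u x≈0)

linℤ-cong : ∀ g {x y} → x ≋ y → linℤ g x ≡ linℤ g y
linℤ-cong g {x} {y} (mk≋ x≈y) = begin
  linℤ g x
    ≡⟨ solve 2 (λ a b → a := (a :+ con -1ℤ :* b) :+ b) refl (linℤ g x) (linℤ g y) ⟩
  (linℤ g x ℤ.+ -1ℤ ℤ.* linℤ g y) ℤ.+ linℤ g y
    ≡⟨ cong (ℤ._+ linℤ g y) (trans (sym linℤ-difference) (linℤ-≋[] g difference≋[])) ⟩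
  + 0 ℤ.+ linℤ g y
    ≡⟨ ℤ.+-identityˡ _ ⟩
  linℤ g y ∎
  where
  open ≡-Reasoning
  open +-*-Solver
  linℤ-difference : linℤ g (x ⊕ -1ℤ · y) ≡ linℤ g x ℤ.+ -1ℤ ℤ.* linℤ g y
  linℤ-difference = trans (linℤ-++ g x (-1ℤ · y)) (cong (λ z → linℤ g x ℤ.+ z) (linℤ-· g -1ℤ y))
  difference≋[] : x ⊕ -1ℤ · y ≋ []
  difference≋[] = mk≋ λ w → begin
    coeff w (x ⊕ -1ℤ · y)            ≡⟨ coeff-++ w x (-1ℤ · y) ⟩
    coeff w x ℤ.+ coeff w (-1ℤ · y)  ≡⟨ cong₂ ℤ._+_ (x≈y w) (trans (coeff-· w -1ℤ y) (ℤ.-1*i≡-i _)) ⟩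
    coeff w y ℤ.- coeff w y          ≡⟨ ℤ.+-inverseʳ (coeff w y) ⟩
    + 0                              ∎

lin-cong : ∀ f {x y} → x ≋ y → lin f x ≋ lin f y
lin-cong f {x} {y} x≋y = mk≋ λ w →
  trans (coeff-lin w f x) (trans (linℤ-cong _ x≋y) (sym (coeff-lin w f y)))

lin-pointwise : ∀ {f g} x → (∀ u → f u ≋ g u) → lin f x ≋ lin g x
lin-pointwise []            f≋g = ≋-refl
lin-pointwise ((c , u) ∷ x) f≋g = ⊕-cong (·-cong c (f≋g u)) (lin-pointwise x f≋g)

lin-++ : ∀ f x y → lin f (x ++ y) ≡ lin f x ⊕ lin f y
lin-++ f []            y = refl
lin-++ f ((c , u) ∷ x) y = trans (cong (c · f u ⊕_) (lin-++ f x y)) (sym (List.++-assoc (c · f u) _ _))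

lin-· : ∀ f d x → lin f (d · x) ≋ d · lin f x
lin-· f d []            = ≋-refl
lin-· f d ((c , u) ∷ x) = ≋-trans
  (⊕-cong (≋-sym (·-assoc d c (f u))) (lin-· f d x))
  (≋-sym (·-distribˡ-⊕ d (c · f u) (lin f x)))

lin-⟦⟧ : ∀ f u → lin f ⟦ u ⟧ ≋ f u
lin-⟦⟧ f u = ≋-trans (⊕-identityʳ _) (·-identityˡ (f u))

lin-⟦⟧-identity : ∀ x → lin ⟦_⟧ x ≋ x
lin-⟦⟧-identity []            = ≋-refl
lin-⟦⟧-identity ((c , u) ∷ x) =
  ⊕-cong {y = lin ⟦_⟧ x} (≡⇒≋ (cong (λ d → (d , u) ∷ []) (ℤ.*-identityʳ c))) (lin-⟦⟧-identity x)

lin-∘ : ∀ f g x → lin f (lin g x) ≋ lin (λ u → lin f (g u)) x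
lin-∘ f g []            = ≋-refl
lin-∘ f g ((c , u) ∷ x) = ≋-trans (≡⇒≋ (lin-++ f (c · g u) (lin g x)))
  (⊕-cong (lin-· f c (g u)) (lin-∘ f g x))

lin-⊕ᶠ : ∀ f g x → lin (λ u → f u ⊕ g u) x ≋ lin f x ⊕ lin g x
lin-⊕ᶠ f g []            = ≋-refl
lin-⊕ᶠ f g ((c , u) ∷ x) = ≋-trans
  (⊕-cong (·-distribˡ-⊕ c (f u) (g u)) (lin-⊕ᶠ f g x))
  (interchange (c · f u) (c · g u) (lin f x) (lin g x))

lin-·ᶠ : ∀ d f x → lin (λ u → d · f u) x ≋ d · lin f x
lin-·ᶠ d f []            = ≋-refl
lin-·ᶠ d f ((c , u) ∷ x) = ≋-trans
  (⊕-cong (≋-trans (·-assoc c d (f u))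
            (≋-trans (≡⇒≋ (cong (_· f u) (ℤ.*-comm c d))) (≋-sym (·-assoc d c (f u)))))
          (lin-·ᶠ d f x))
  (≋-sym (·-distribˡ-⊕ d (c · f u) (lin f x)))

lin-[]ᶠ : ∀ x → lin (λ _ → []) x ≡ []
lin-[]ᶠ []            = refl
lin-[]ᶠ ((c , u) ∷ x) = lin-[]ᶠ x

lin-swap : ∀ (F : Word → Word → Lin) x y →
  lin (λ u → lin (F u) y) x ≋ lin (λ v → lin (λ u → F u v) x) y
lin-swap F []            y = ≡⇒≋ (sym (lin-[]ᶠ y))
lin-swap F ((c , u) ∷ x) y = ≋-sym (≋-trans
  (lin-⊕ᶠ (λ v → c · F u v) (λ v → lin (λ u → F u v) x) y)
  (⊕-cong (lin-·ᶠ c (F u) y) (≋-sym (lin-swap F x y))))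

mapW : (Word → Word) → Lin → Lin
mapW φ = lin (λ u → ⟦ φ u ⟧)

pre : ℕ → Lin → Lin
pre a = mapW (a ∷_)

post : ℕ → Lin → Lin
post a = mapW (λ u → u ++ a ∷ [])

lin-mapW : ∀ f φ x → lin f (mapW φ x) ≋ lin (λ u → f (φ u)) x
lin-mapW f φ x = ≋-trans (lin-∘ f (λ u → ⟦ φ u ⟧) x) (lin-pointwise x (λ u → lin-⟦⟧ f (φ u)))

mapW-cong : ∀ φ {x y} → x ≋ y → mapW φ x ≋ mapW φ y
mapW-cong φ = lin-cong (λ u → ⟦ φ u ⟧)

pre-cong : ∀ a {x y} → x ≋ y → pre a x ≋ pre a y
pre-cong a = mapW-cong (a ∷_)

post-cong : ∀ a {x y} → x ≋ y → post a x ≋ post a y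
post-cong a = mapW-cong (λ u → u ++ a ∷ [])

post-· : ∀ a c x → post a (c · x) ≋ c · post a x
post-· a = lin-· (λ u → ⟦ u ++ a ∷ [] ⟧)

mapW-⊕ : ∀ φ x y → mapW φ (x ⊕ y) ≡ mapW φ x ⊕ mapW φ y
mapW-⊕ φ = lin-++ (λ u → ⟦ φ u ⟧)

mapW-⟦⟧ : ∀ φ u → mapW φ ⟦ u ⟧ ≋ ⟦ φ u ⟧
mapW-⟦⟧ φ = lin-⟦⟧ (λ u → ⟦ φ u ⟧)

pre-post : ∀ a b x → post b (pre a x) ≋ pre a (post b x)
pre-post a b x = ≋-trans (lin-mapW _ (a ∷_) x) (≋-sym (lin-mapW _ (λ u → u ++ b ∷ []) x))

bilin : (Word → Word → Lin) → Lin → Lin → Lin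
bilin G x y = lin (λ u → lin (G u) y) x

sh : Lin → Lin → Lin
sh = bilin shw

catw : Word → Word → Lin
catw u v = ⟦ u ++ v ⟧

cat : Lin → Lin → Lin
cat = bilin catw

bilin-congˡ : ∀ G {x x′} y → x ≋ x′ → bilin G x y ≋ bilin G x′ y
bilin-congˡ G y = lin-cong _

bilin-congʳ : ∀ G x {y y′} → y ≋ y′ → bilin G x y ≋ bilin G x y′
bilin-congʳ G x y≋y′ = lin-pointwise x (λ u → lin-cong (G u) y≋y′)

bilin-pointwise : ∀ {G H} x y → (∀ u v → G u v ≋ H u v) → bilin G x y ≋ bilin H x y
bilin-pointwise x y G≋H = lin-pointwise x (λ u → lin-pointwise y (G≋H u))

bilin-mapWˡ : ∀ G φ x y → bilin G (mapW φ x) y ≋ bilin (λ u v → G (φ u) v) x y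
bilin-mapWˡ G φ x y = lin-mapW (λ u → lin (G u) y) φ x

bilin-mapWʳ : ∀ G ψ x y → bilin G x (mapW ψ y) ≋ bilin (λ u v → G u (ψ v)) x y
bilin-mapWʳ G ψ x y = lin-pointwise x (λ u → lin-mapW (G u) ψ y)

lin-bilin : ∀ f G x y → lin f (bilin G x y) ≋ bilin (λ u v → lin f (G u v)) x y
lin-bilin f G x y = ≋-trans (lin-∘ f _ x) (lin-pointwise x (λ u → lin-∘ f (G u) y))

bilin-⊕ᶠ : ∀ G H x y → bilin (λ u v → G u v ⊕ H u v) x y ≋ bilin G x y ⊕ bilin H x y
bilin-⊕ᶠ G H x y = ≋-trans (lin-pointwise x (λ u → lin-⊕ᶠ (G u) (H u) y)) (lin-⊕ᶠ _ _ x)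

bilin-⟦⟧ˡ : ∀ G u y → bilin G ⟦ u ⟧ y ≋ lin (G u) y
bilin-⟦⟧ˡ G u y = lin-⟦⟧ (λ u → lin (G u) y) u

bilin-⟦⟧ʳ : ∀ G x v → bilin G x ⟦ v ⟧ ≋ lin (λ u → G u v) x
bilin-⟦⟧ʳ G x v = lin-pointwise x (λ u → lin-⟦⟧ (G u) v)

bilin-⊕ʳ : ∀ G x y y′ → bilin G x (y ⊕ y′) ≋ bilin G x y ⊕ bilin G x y′
bilin-⊕ʳ G x y y′ = ≋-trans (lin-pointwise x (λ u → ≡⇒≋ (lin-++ (G u) y y′))) (lin-⊕ᶠ _ _ x)

bilin-·ʳ : ∀ G c x y → bilin G x (c · y) ≋ c · bilin G x y
bilin-·ʳ G c x y = ≋-trans (lin-pointwise x (λ u → lin-· (G u) c y)) (lin-·ᶠ c _ x)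

bilin-[]ʳ : ∀ G x → bilin G x [] ≡ []
bilin-[]ʳ G = lin-[]ᶠ

⧢-≋-sh : ∀ x y → x ⧢ y ≋ sh x y
⧢-≋-sh []            y = ≋-refl
⧢-≋-sh ((c , u) ∷ x) y = ⊕-cong (row y) (⧢-≋-sh x y)
  where
  row : ∀ y → concatMap (λ { (d , v) → (c ℤ.* d) · shw u v }) y ≋ c · lin (shw u) y
  row []            = ≋-refl
  row ((d , v) ∷ y) = ≋-trans (⊕-cong (≋-sym (·-assoc c d (shw u v))) (row y))
    (≋-sym (·-distribˡ-⊕ c (d · shw u v) (lin (shw u) y)))

⋆-≋-cat : ∀ x y → x ⋆ y ≋ cat x y
⋆-≋-cat []            y = ≋-refl
⋆-≋-cat ((c , u) ∷ x) y = ⊕-cong (≡⇒≋ (row y)) (⋆-≋-cat x y)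
  where
  row : ∀ y → map (λ { (d , v) → (c ℤ.* d , u ++ v) }) y ≡ c · lin (λ v → ⟦ u ++ v ⟧) y
  row []            = refl
  row ((d , v) ∷ y) = cong₂ _∷_ (cong (λ e → c ℤ.* e , u ++ v) (sym (ℤ.*-identityʳ d))) (row y)

cat-identityʳ : ∀ x → cat x ⟦ [] ⟧ ≋ x
cat-identityʳ x = ≋-trans (bilin-⟦⟧ʳ catw x [])
  (≋-trans (lin-pointwise x (λ u → ≡⇒≋ (cong ⟦_⟧ (List.++-identityʳ u)))) (lin-⟦⟧-identity x))

cat-ltrʳ : ∀ x a → cat x (ltr a) ≋ post a x
cat-ltrʳ x a = bilin-⟦⟧ʳ catw x (a ∷ [])

cat-postʳ : ∀ x a y → cat x (post a y) ≋ post a (cat x y)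
cat-postʳ x a y = ≋-trans (bilin-mapWʳ catw (λ v → v ++ a ∷ []) x y) (≋-sym (≋-trans (lin-bilin _ catw x y)
  (bilin-pointwise x y λ u v →
    ≋-trans (mapW-⟦⟧ (λ w → w ++ a ∷ []) (u ++ v)) (≡⇒≋ (cong ⟦_⟧ (List.++-assoc u v (a ∷ [])))))))

⧢⋆ltr : ∀ x y a → (x ⧢ y) ⋆ ltr a ≋ post a (sh x y)
⧢⋆ltr x y a = ≋-trans (⋆-≋-cat (x ⧢ y) (ltr a))
  (≋-trans (cat-ltrʳ (x ⧢ y) a) (post-cong a (⧢-≋-sh x y)))

shw-[]ʳ : ∀ u → shw u [] ≡ ⟦ u ⟧
shw-[]ʳ []      = refl
shw-[]ʳ (a ∷ u) = refl

map-∷≡pre : ∀ a x → map (λ { (c , w) → (c , a ∷ w) }) x ≡ pre a x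
map-∷≡pre a []            = refl
map-∷≡pre a ((c , w) ∷ x) =
  cong₂ _∷_ (cong (λ d → d , a ∷ w) (sym (ℤ.*-identityʳ c))) (map-∷≡pre a x)

shw-∷∷ : ∀ a u b v → shw (a ∷ u) (b ∷ v) ≡ pre a (shw u (b ∷ v)) ⊕ pre b (shw (a ∷ u) v)
shw-∷∷ a u b v = cong₂ _⊕_ (map-∷≡pre a (shw u (b ∷ v))) (map-∷≡pre b (shw (a ∷ u) v))

⟦∷⟧≋pre : ∀ a u → ⟦ a ∷ u ⟧ ≋ pre a ⟦ u ⟧
⟦∷⟧≋pre a u = ≋-sym (mapW-⟦⟧ (a ∷_) u)

⟦++⟧≋post : ∀ a u → ⟦ u ++ a ∷ [] ⟧ ≋ post a ⟦ u ⟧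
⟦++⟧≋post a u = ≋-sym (mapW-⟦⟧ (λ u → u ++ a ∷ []) u)

sh-identityˡ : ∀ y → sh ⟦ [] ⟧ y ≋ y
sh-identityˡ y = ≋-trans (bilin-⟦⟧ˡ shw [] y) (lin-⟦⟧-identity y)

sh-identityʳ : ∀ x → sh x ⟦ [] ⟧ ≋ x
sh-identityʳ x = ≋-trans (bilin-⟦⟧ʳ shw x [])
  (≋-trans (lin-pointwise x (λ u → ≡⇒≋ (shw-[]ʳ u))) (lin-⟦⟧-identity x))

sh-emptyˡ : ∀ {x} → x ≡ ⟦ [] ⟧ → ∀ y → sh x y ≋ y
sh-emptyˡ refl = sh-identityˡ

sh-emptyʳ : ∀ x {y} → y ≡ ⟦ [] ⟧ → sh x y ≋ x
sh-emptyʳ x refl = sh-identityʳ x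

sh-⟦⟧⟦⟧ : ∀ u v → sh ⟦ u ⟧ ⟦ v ⟧ ≋ shw u v
sh-⟦⟧⟦⟧ u v = ≋-trans (bilin-⟦⟧ˡ shw u ⟦ v ⟧) (lin-⟦⟧ (shw u) v)

sh-⊕ˡ : ∀ x x′ y → sh (x ⊕ x′) y ≡ sh x y ⊕ sh x′ y
sh-⊕ˡ x x′ y = lin-++ _ x x′

sh-mapW-mapW : ∀ φ ψ α β → (∀ u v → shw (φ u) (ψ v) ≋ mapW α (shw u (ψ v)) ⊕ mapW β (shw (φ u) v)) →
  ∀ x y → sh (mapW φ x) (mapW ψ y) ≋ mapW α (sh x (mapW ψ y)) ⊕ mapW β (sh (mapW φ x) y)
sh-mapW-mapW φ ψ α β shw-rec x y = begin
  sh (mapW φ x) (mapW ψ y)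
    ≈⟨ ≋-trans (bilin-mapWˡ shw φ x (mapW ψ y)) (bilin-mapWʳ (λ u → shw (φ u)) ψ x y) ⟩
  bilin (λ u v → shw (φ u) (ψ v)) x y
    ≈⟨ bilin-pointwise x y shw-rec ⟩
  bilin (λ u v → mapW α (shw u (ψ v)) ⊕ mapW β (shw (φ u) v)) x y
    ≈⟨ bilin-⊕ᶠ _ _ x y ⟩
  bilin (λ u v → mapW α (shw u (ψ v))) x y ⊕ bilin (λ u v → mapW β (shw (φ u) v)) x y
    ≈⟨ ⊕-cong (≋-sym (≋-trans (lin-bilin _ shw x (mapW ψ y)) (bilin-mapWʳ _ ψ x y)))
              (≋-sym (≋-trans (lin-bilin _ shw (mapW φ x) y) (bilin-mapWˡ _ φ x y))) ⟩
  mapW α (sh x (mapW ψ y)) ⊕ mapW β (sh (mapW φ x) y) ∎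
  where open SetoidReasoning ≋-setoid

sh-pre-pre : ∀ a b x y → sh (pre a x) (pre b y) ≋ pre a (sh x (pre b y)) ⊕ pre b (sh (pre a x) y)
sh-pre-pre a b = sh-mapW-mapW (a ∷_) (b ∷_) (a ∷_) (b ∷_) (λ u v → ≡⇒≋ (shw-∷∷ a u b v))

sh-shw-∷ˡ : ∀ a u b v c w →
  sh (shw (a ∷ u) (b ∷ v)) ⟦ c ∷ w ⟧ ≋
    (pre a (sh (shw u (b ∷ v)) ⟦ c ∷ w ⟧) ⊕ pre b (sh (shw (a ∷ u) v) ⟦ c ∷ w ⟧))
    ⊕ pre c (sh (shw (a ∷ u) (b ∷ v)) ⟦ w ⟧)
sh-shw-∷ˡ a u b v c w = begin
  sh (shw (a ∷ u) (b ∷ v)) C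
    ≡⟨ split C ⟩
  sh (pre a P) C ⊕ sh (pre b Q) C
    ≈⟨ ⊕-cong (bilin-congʳ shw (pre a P) C≋cW) (bilin-congʳ shw (pre b Q) C≋cW) ⟩
  sh (pre a P) (pre c W) ⊕ sh (pre b Q) (pre c W)
    ≈⟨ ⊕-cong (sh-pre-pre a c P W) (sh-pre-pre b c Q W) ⟩
  (pre a (sh P (pre c W)) ⊕ pre c (sh (pre a P) W)) ⊕ (pre b (sh Q (pre c W)) ⊕ pre c (sh (pre b Q) W))
    ≈⟨ interchange (pre a (sh P (pre c W))) (pre c (sh (pre a P) W))
                   (pre b (sh Q (pre c W))) (pre c (sh (pre b Q) W)) ⟩
  (pre a (sh P (pre c W)) ⊕ pre b (sh Q (pre c W))) ⊕ (pre c (sh (pre a P) W) ⊕ pre c (sh (pre b Q) W))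
    ≡⟨ cong (pre a (sh P (pre c W)) ⊕ pre b (sh Q (pre c W)) ⊕_)
            (sym (trans (cong (pre c) (split W)) (mapW-⊕ (c ∷_) (sh (pre a P) W) (sh (pre b Q) W)))) ⟩
  (pre a (sh P (pre c W)) ⊕ pre b (sh Q (pre c W))) ⊕ pre c (sh (shw (a ∷ u) (b ∷ v)) W)
    ≈⟨ ⊕-congʳ (⊕-cong (pre-cong a (bilin-congʳ shw P (≋-sym C≋cW)))
                        (pre-cong b (bilin-congʳ shw Q (≋-sym C≋cW)))) ⟩
  (pre a (sh P C) ⊕ pre b (sh Q C)) ⊕ pre c (sh (shw (a ∷ u) (b ∷ v)) W) ∎
  where
  open SetoidReasoning ≋-setoid
  P Q C W : Lin
  P = shw u (b ∷ v)
  Q = shw (a ∷ u) v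
  C = ⟦ c ∷ w ⟧
  W = ⟦ w ⟧
  C≋cW : C ≋ pre c W
  C≋cW = ⟦∷⟧≋pre c w
  split : ∀ y → sh (shw (a ∷ u) (b ∷ v)) y ≡ sh (pre a P) y ⊕ sh (pre b Q) y
  split y = trans (cong (λ z → sh z y) (shw-∷∷ a u b v)) (sh-⊕ˡ (pre a P) (pre b Q) y)

sh-shw-∷ʳ : ∀ a u b v c w →
  sh ⟦ a ∷ u ⟧ (shw (b ∷ v) (c ∷ w)) ≋
    (pre a (sh ⟦ u ⟧ (shw (b ∷ v) (c ∷ w))) ⊕ pre b (sh ⟦ a ∷ u ⟧ (shw v (c ∷ w))))
    ⊕ pre c (sh ⟦ a ∷ u ⟧ (shw (b ∷ v) w))
sh-shw-∷ʳ a u b v c w = begin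
  sh A (shw (b ∷ v) (c ∷ w))
    ≈⟨ ≋-trans (≡⇒≋ (cong (sh A) (shw-∷∷ b v c w))) (bilin-⊕ʳ shw A (pre b R) (pre c S)) ⟩
  sh A (pre b R) ⊕ sh A (pre c S)
    ≈⟨ ⊕-cong (bilin-congˡ shw (pre b R) A≋aU) (bilin-congˡ shw (pre c S) A≋aU) ⟩
  sh (pre a U) (pre b R) ⊕ sh (pre a U) (pre c S)
    ≈⟨ ⊕-cong (sh-pre-pre a b U R) (sh-pre-pre a c U S) ⟩
  (pre a (sh U (pre b R)) ⊕ pre b (sh (pre a U) R)) ⊕ (pre a (sh U (pre c S)) ⊕ pre c (sh (pre a U) S))
    ≈⟨ interchange (pre a (sh U (pre b R))) (pre b (sh (pre a U) R))
                   (pre a (sh U (pre c S))) (pre c (sh (pre a U) S)) ⟩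
  (pre a (sh U (pre b R)) ⊕ pre a (sh U (pre c S))) ⊕ (pre b (sh (pre a U) R) ⊕ pre c (sh (pre a U) S))
    ≈⟨ ⊕-cong (≋-sym (≋-trans (pre-cong a (bilin-⊕ʳ shw U (pre b R) (pre c S)))
                               (≡⇒≋ (mapW-⊕ (a ∷_) (sh U (pre b R)) (sh U (pre c S))))))
              (⊕-cong (pre-cong b (bilin-congˡ shw R (≋-sym A≋aU)))
                      (pre-cong c (bilin-congˡ shw S (≋-sym A≋aU)))) ⟩
  pre a (sh U (pre b R ⊕ pre c S)) ⊕ (pre b (sh A R) ⊕ pre c (sh A S))
    ≈⟨ ≋-sym (⊕-assoc (pre a (sh U (pre b R ⊕ pre c S))) (pre b (sh A R)) (pre c (sh A S))) ⟩
  (pre a (sh U (pre b R ⊕ pre c S)) ⊕ pre b (sh A R)) ⊕ pre c (sh A S)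
    ≡⟨ cong (λ z → (pre a (sh U z) ⊕ pre b (sh A R)) ⊕ pre c (sh A S)) (sym (shw-∷∷ b v c w)) ⟩
  (pre a (sh U (shw (b ∷ v) (c ∷ w))) ⊕ pre b (sh A R)) ⊕ pre c (sh A S) ∎
  where
  open SetoidReasoning ≋-setoid
  A U R S : Lin
  A = ⟦ a ∷ u ⟧
  U = ⟦ u ⟧
  R = shw v (c ∷ w)
  S = shw (b ∷ v) w
  A≋aU : A ≋ pre a U
  A≋aU = ⟦∷⟧≋pre a u

shw-assoc : ∀ u v w → sh (shw u v) ⟦ w ⟧ ≋ sh ⟦ u ⟧ (shw v w)
shw-assoc []      v       w       = ≋-trans (sh-⟦⟧⟦⟧ v w) (≋-sym (sh-identityˡ (shw v w)))
shw-assoc (a ∷ u) []      w       = ≋-refl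
shw-assoc (a ∷ u) (b ∷ v) []      = ≋-trans (sh-identityʳ _) (≋-sym (sh-⟦⟧⟦⟧ (a ∷ u) (b ∷ v)))
shw-assoc (a ∷ u) (b ∷ v) (c ∷ w) = ≋-trans (sh-shw-∷ˡ a u b v c w) (≋-trans
  (⊕-cong (⊕-cong (pre-cong a (shw-assoc u (b ∷ v) (c ∷ w))) (pre-cong b (shw-assoc (a ∷ u) v (c ∷ w))))
          (pre-cong c (shw-assoc (a ∷ u) (b ∷ v) w)))
  (≋-sym (sh-shw-∷ʳ a u b v c w)))

-- Both sides are trilinear, so associativity on basis words suffices.
sh-assoc : ∀ x y z → sh (sh x y) z ≋ sh x (sh y z)
sh-assoc x y z = ≋-trans left (≋-sym right)
  where
  basis : Lin
  basis = lin (λ t → lin (λ s → lin (λ w → sh ⟦ t ⟧ (shw s w)) z) y) x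
  left : sh (sh x y) z ≋ basis
  left = ≋-trans (lin-∘ (λ r → lin (shw r) z) _ x) (lin-pointwise x λ t →
         ≋-trans (lin-∘ (λ r → lin (shw r) z) (shw t) y) (lin-pointwise y λ s →
         ≋-trans (lin-swap shw (shw t s) z) (lin-pointwise z λ w →
         ≋-trans (≋-sym (bilin-⟦⟧ʳ shw (shw t s) w)) (shw-assoc t s w))))
  right : sh x (sh y z) ≋ basis
  right = lin-pointwise x λ t →
          ≋-trans (lin-∘ (shw t) _ y) (lin-pointwise y λ s →
          ≋-trans (lin-∘ (shw t) (shw s) z) (lin-pointwise z λ w →
          ≋-sym (bilin-⟦⟧ˡ shw t (shw s w))))

pre-post-interchange : ∀ x y a b {s t} A₁ B₁ A₂ B₂ →
  s ≋ post a A₁ ⊕ post b B₁ → t ≋ post a A₂ ⊕ post b B₂ →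
  pre x s ⊕ pre y t ≋ post a (pre x A₁ ⊕ pre y A₂) ⊕ post b (pre x B₁ ⊕ pre y B₂)
pre-post-interchange x y a b {s} {t} A₁ B₁ A₂ B₂ s≋ t≋ = begin
  pre x s ⊕ pre y t
    ≈⟨ ⊕-cong (pre-cong x s≋) (pre-cong y t≋) ⟩
  pre x (post a A₁ ⊕ post b B₁) ⊕ pre y (post a A₂ ⊕ post b B₂)
    ≡⟨ cong₂ _⊕_ (mapW-⊕ (x ∷_) (post a A₁) (post b B₁)) (mapW-⊕ (y ∷_) (post a A₂) (post b B₂)) ⟩
  (pre x (post a A₁) ⊕ pre x (post b B₁)) ⊕ (pre y (post a A₂) ⊕ pre y (post b B₂))
    ≈⟨ interchange (pre x (post a A₁)) (pre x (post b B₁)) (pre y (post a A₂)) (pre y (post b B₂)) ⟩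
  (pre x (post a A₁) ⊕ pre y (post a A₂)) ⊕ (pre x (post b B₁) ⊕ pre y (post b B₂))
    ≈⟨ ≋-sym (⊕-cong (⊕-cong (pre-post x a A₁) (pre-post y a A₂))
                     (⊕-cong (pre-post x b B₁) (pre-post y b B₂))) ⟩
  (post a (pre x A₁) ⊕ post a (pre y A₂)) ⊕ (post b (pre x B₁) ⊕ post b (pre y B₂))
    ≡⟨ sym (cong₂ _⊕_ (mapW-⊕ _ (pre x A₁) (pre y A₂)) (mapW-⊕ _ (pre x B₁) (pre y B₂))) ⟩
  post a (pre x A₁ ⊕ pre y A₂) ⊕ post b (pre x B₁ ⊕ pre y B₂) ∎
  where open SetoidReasoning ≋-setoid

shw-snoc-snoc : ∀ u v a b →
  shw (u ++ a ∷ []) (v ++ b ∷ []) ≋ post a (shw u (v ++ b ∷ [])) ⊕ post b (shw (u ++ a ∷ []) v)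
shw-snoc-snoc [] [] a b = ≋-trans
  (⊕-cong (≋-trans (mapW-⟦⟧ (a ∷_) (b ∷ [])) (⟦++⟧≋post b (a ∷ [])))
          (≋-trans (mapW-⟦⟧ (b ∷_) (a ∷ [])) (⟦++⟧≋post a (b ∷ []))))
  (⊕-comm (post b ⟦ a ∷ [] ⟧) (post a ⟦ b ∷ [] ⟧))
shw-snoc-snoc [] (y ∷ v) a b = begin
  shw (a ∷ []) (y ∷ v ++ b ∷ [])
    ≡⟨ shw-∷∷ a [] y (v ++ b ∷ []) ⟩
  pre a ⟦ y ∷ v ++ b ∷ [] ⟧ ⊕ pre y (shw (a ∷ []) (v ++ b ∷ []))
    ≈⟨ pre-post-interchange a y a b [] ⟦ y ∷ v ⟧ ⟦ v ++ b ∷ [] ⟧ (shw (a ∷ []) v)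
         (⟦++⟧≋post b (y ∷ v)) (shw-snoc-snoc [] v a b) ⟩
  post a (pre y ⟦ v ++ b ∷ [] ⟧) ⊕ post b (pre a ⟦ y ∷ v ⟧ ⊕ pre y (shw (a ∷ []) v))
    ≈⟨ ⊕-cong (post-cong a (mapW-⟦⟧ (y ∷_) (v ++ b ∷ [])))
              (≡⇒≋ (cong (post b) (sym (shw-∷∷ a [] y v)))) ⟩
  post a ⟦ y ∷ v ++ b ∷ [] ⟧ ⊕ post b (shw (a ∷ []) (y ∷ v)) ∎
  where open SetoidReasoning ≋-setoid
shw-snoc-snoc (x ∷ u) [] a b = begin
  shw (x ∷ u ++ a ∷ []) (b ∷ [])
    ≡⟨ shw-∷∷ x (u ++ a ∷ []) b [] ⟩
  pre x (shw (u ++ a ∷ []) (b ∷ [])) ⊕ pre b ⟦ x ∷ u ++ a ∷ [] ⟧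
    ≈⟨ pre-post-interchange x b a b (shw u (b ∷ [])) (shw (u ++ a ∷ []) []) ⟦ x ∷ u ⟧ []
         (shw-snoc-snoc u [] a b) (≋-trans (⟦++⟧≋post a (x ∷ u)) (≋-sym (⊕-identityʳ _))) ⟩
  post a (pre x (shw u (b ∷ [])) ⊕ pre b ⟦ x ∷ u ⟧) ⊕ post b (pre x (shw (u ++ a ∷ []) []) ⊕ [])
    ≈⟨ ⊕-cong (≡⇒≋ (cong (post a) (sym (shw-∷∷ x u b []))))
              (post-cong b (≋-trans (⊕-identityʳ _) (≋-trans (≡⇒≋ (cong (pre x) (shw-[]ʳ (u ++ a ∷ []))))
                                                             (mapW-⟦⟧ (x ∷_) (u ++ a ∷ []))))) ⟩
  post a (shw (x ∷ u) (b ∷ [])) ⊕ post b ⟦ x ∷ u ++ a ∷ [] ⟧ ∎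
  where open SetoidReasoning ≋-setoid
shw-snoc-snoc (x ∷ u) (y ∷ v) a b = ≋-trans
  (≡⇒≋ (shw-∷∷ x (u ++ a ∷ []) y (v ++ b ∷ []))) (≋-trans
  (pre-post-interchange x y a b
    (shw u (y ∷ v ++ b ∷ [])) (shw (u ++ a ∷ []) (y ∷ v))
    (shw (x ∷ u) (v ++ b ∷ [])) (shw (x ∷ u ++ a ∷ []) v)
    (shw-snoc-snoc u (y ∷ v) a b) (shw-snoc-snoc (x ∷ u) v a b))
  (≡⇒≋ (sym (cong₂ _⊕_ (cong (post a) (shw-∷∷ x u y (v ++ b ∷ [])))
                       (cong (post b) (shw-∷∷ x (u ++ a ∷ []) y v))))))

sh-post-post : ∀ a b x y → sh (post a x) (post b y) ≋ post a (sh x (post b y)) ⊕ post b (sh (post a x) y)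
sh-post-post a b = sh-mapW-mapW _ _ _ _ (λ u v → shw-snoc-snoc u v a b)

η≡⟦upFrom⟧ : ∀ a l → a ≤ suc l → η a l ≡ ⟦ upFrom a (suc l ∸ a) ⟧
η≡⟦upFrom⟧ a l a≤ with a ≤? suc l
... | yes _  = refl
... | no  a≰ = ⊥-elim (a≰ a≤)

δ≡⟦upFrom⟧ : ∀ l a → a ≤ suc l → δ l a ≡ ⟦ reverse (upFrom a (suc l ∸ a)) ⟧
δ≡⟦upFrom⟧ l a a≤ with a ≤? suc l
... | yes _  = refl
... | no  a≰ = ⊥-elim (a≰ a≤)

η-empty : ∀ l → η (suc l) l ≡ ⟦ [] ⟧
η-empty l = trans (η≡⟦upFrom⟧ (suc l) l ℕ.≤-refl) (cong (λ m → ⟦ upFrom (suc l) m ⟧) (ℕ.n∸n≡0 l))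

δ-empty : ∀ l → δ l (suc l) ≡ ⟦ [] ⟧
δ-empty l = trans (δ≡⟦upFrom⟧ l (suc l) ℕ.≤-refl)
                  (cong (λ m → ⟦ reverse (upFrom (suc l) m) ⟧) (ℕ.n∸n≡0 l))

η-zero : ∀ l → η (suc (suc l)) l ≡ []
η-zero l with suc (suc l) ≤? suc l
... | yes 2+l≤1+l = ⊥-elim (ℕ.1+n≰n 2+l≤1+l)
... | no  _       = refl

δ-zero : ∀ l → δ l (suc (suc l)) ≡ []
δ-zero l with suc (suc l) ≤? suc l
... | yes 2+l≤1+l = ⊥-elim (ℕ.1+n≰n 2+l≤1+l)
... | no  _       = refl

upFrom-snoc : ∀ a m → upFrom a (suc m) ≡ upFrom a m ++ a + m ∷ []
upFrom-snoc a zero    = cong (_∷ []) (sym (ℕ.+-identityʳ a))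
upFrom-snoc a (suc m) = cong (a ∷_)
  (trans (upFrom-snoc (suc a) m) (cong (λ b → upFrom (suc a) m ++ b ∷ []) (sym (ℕ.+-suc a m))))

upFrom-up-to-suc : ∀ a l → a ≤ suc l → upFrom a (suc (suc l) ∸ a) ≡ upFrom a (suc l ∸ a) ++ suc l ∷ []
upFrom-up-to-suc a l a≤ = begin
  upFrom a (suc (suc l) ∸ a)
    ≡⟨ cong (upFrom a) (ℕ.+-∸-assoc 1 a≤) ⟩
  upFrom a (suc (suc l ∸ a))
    ≡⟨ upFrom-snoc a (suc l ∸ a) ⟩
  upFrom a (suc l ∸ a) ++ a + (suc l ∸ a) ∷ []
    ≡⟨ cong (λ b → upFrom a (suc l ∸ a) ++ b ∷ []) (ℕ.m+[n∸m]≡n a≤) ⟩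
  upFrom a (suc l ∸ a) ++ suc l ∷ [] ∎
  where open ≡-Reasoning

η-snoc : ∀ a l → a ≤ suc l → η a (suc l) ≋ post (suc l) (η a l)
η-snoc a l a≤ = ≋-trans
  (≡⇒≋ (trans (η≡⟦upFrom⟧ a (suc l) (ℕ.m≤n⇒m≤1+n a≤)) (cong ⟦_⟧ (upFrom-up-to-suc a l a≤))))
  (≋-trans (⟦++⟧≋post (suc l) (upFrom a (suc l ∸ a)))
           (≡⇒≋ (cong (post (suc l)) (sym (η≡⟦upFrom⟧ a l a≤)))))

δ-cons : ∀ l a → a ≤ suc l → δ (suc l) a ≋ pre (suc l) (δ l a)
δ-cons l a a≤ = ≋-trans
  (≡⇒≋ (trans (δ≡⟦upFrom⟧ (suc l) a (ℕ.m≤n⇒m≤1+n a≤))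
         (cong ⟦_⟧ (trans (cong reverse (upFrom-up-to-suc a l a≤))
                          (List.reverse-++ (upFrom a (suc l ∸ a)) (suc l ∷ []))))))
  (≋-trans (⟦∷⟧≋pre (suc l) (reverse (upFrom a (suc l ∸ a))))
           (≡⇒≋ (cong (pre (suc l)) (sym (δ≡⟦upFrom⟧ l a a≤)))))

η-cons : ∀ a l → a ≤ l → η a l ≋ pre a (η (suc a) l)
η-cons a l a≤ = ≋-trans
  (≡⇒≋ (trans (η≡⟦upFrom⟧ a l (ℕ.m≤n⇒m≤1+n a≤)) (cong (λ m → ⟦ upFrom a m ⟧) (ℕ.+-∸-assoc 1 a≤))))
  (≋-trans (⟦∷⟧≋pre a (upFrom (suc a) (l ∸ a)))
           (≡⇒≋ (cong (pre a) (sym (η≡⟦upFrom⟧ (suc a) l (s≤s a≤))))))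

alt : ℕ → ℕ → (ℕ → Lin) → Lin
alt a m g = concatMap (λ i → sgn i · g i) (upFrom a m)

alt-cong : ∀ {g h} a m → (∀ i → a ≤ i → i < a + m → g i ≋ h i) → alt a m g ≋ alt a m h
alt-cong a zero    g≋h = ≋-refl
alt-cong a (suc m) g≋h = ⊕-cong
  (·-cong (sgn a) (g≋h a ℕ.≤-refl (ℕ.m<m+n a (s≤s z≤n))))
  (alt-cong (suc a) m (λ i a<i i<a+m → g≋h i (ℕ.<⇒≤ a<i) (subst (i <_) (sym (ℕ.+-suc a m)) i<a+m)))

alt-⊕ : ∀ (g h : ℕ → Lin) a m → alt a m (λ i → g i ⊕ h i) ≋ alt a m g ⊕ alt a m h
alt-⊕ g h a zero    = ≋-refl
alt-⊕ g h a (suc m) = ≋-trans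
  (⊕-cong (·-distribˡ-⊕ (sgn a) (g a) (h a)) (alt-⊕ g h (suc a) m))
  (interchange (sgn a · g a) (sgn a · h a) (alt (suc a) m g) (alt (suc a) m h))

alt-lin : ∀ f (g : ℕ → Lin) a m → alt a m (λ i → lin f (g i)) ≋ lin f (alt a m g)
alt-lin f g a zero    = ≋-refl
alt-lin f g a (suc m) = ≋-trans
  (⊕-cong (≋-sym (lin-· f (sgn a) (g a))) (alt-lin f g (suc a) m))
  (≡⇒≋ (sym (lin-++ f (sgn a · g a) (alt (suc a) m g))))

alt-sh : ∀ x (g : ℕ → Lin) a m → alt a m (λ i → sh x (g i)) ≋ sh x (alt a m g)
alt-sh x g a zero    = ≡⇒≋ (sym (bilin-[]ʳ shw x))
alt-sh x g a (suc m) = ≋-trans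
  (⊕-cong (≋-sym (bilin-·ʳ shw (sgn a) x (g a))) (alt-sh x g (suc a) m))
  (≋-sym (bilin-⊕ʳ shw x (sgn a · g a) (alt (suc a) m g)))

alt-snoc : ∀ (g : ℕ → Lin) a m → alt a (suc m) g ≋ alt a m g ⊕ sgn (a + m) · g (a + m)
alt-snoc g a m = ≋-trans
  (≡⇒≋ (trans (cong (concatMap (λ i → sgn i · g i)) (upFrom-snoc a m))
              (List.concatMap-++ (λ i → sgn i · g i) (upFrom a m) (a + m ∷ []))))
  (⊕-congˡ (⊕-identityʳ (sgn (a + m) · g (a + m))))

alt-telescope : ∀ (g h : ℕ → Lin) a m → (∀ i → a ≤ i → i ≤ a + m → g i ≋ h i ⊕ h (suc i)) →
  alt a (suc m) g ≋ sgn a · h a ⊕ sgn (a + m) · h (suc (a + m))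
alt-telescope g h a zero g≋ = ≋-trans (⊕-identityʳ (sgn a · g a)) (≋-trans
  (·-cong (sgn a) (g≋ a ℕ.≤-refl (ℕ.m≤m+n a 0)))
  (≋-trans (·-distribˡ-⊕ (sgn a) (h a) (h (suc a)))
           (≡⇒≋ (cong (λ b → sgn a · h a ⊕ sgn b · h (suc b)) (sym (ℕ.+-identityʳ a))))))
alt-telescope g h a (suc m) g≋ = begin
  sgn a · g a ⊕ alt (suc a) (suc m) g
    ≈⟨ ⊕-cong (≋-trans (·-cong (sgn a) (g≋ a ℕ.≤-refl (ℕ.m≤m+n a (suc m))))
                       (·-distribˡ-⊕ (sgn a) (h a) (h (suc a))))
              (alt-telescope g h (suc a) m λ i a<i i≤ →
                 g≋ i (ℕ.<⇒≤ a<i) (subst (i ≤_) (sym (ℕ.+-suc a m)) i≤)) ⟩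
  (sgn a · h a ⊕ sgn a · h (suc a)) ⊕ ((- sgn a) · h (suc a) ⊕ last)
    ≈⟨ ⊕-assoc (sgn a · h a) (sgn a · h (suc a)) _ ⟩
  sgn a · h a ⊕ (sgn a · h (suc a) ⊕ ((- sgn a) · h (suc a) ⊕ last))
    ≈⟨ ⊕-congˡ (≋-trans (x∙yz≈y∙xz (sgn a · h (suc a)) ((- sgn a) · h (suc a)) last) 
                (≋-trans (≋-sym (⊕-assoc ((- sgn a) · h (suc a)) (sgn a · h (suc a)) last))
                         (⊕-congʳ (·-inverseˡ (sgn a) (h (suc a)))))) ⟩
  sgn a · h a ⊕ last
    ≡⟨ cong (λ b → sgn a · h a ⊕ sgn b · h (suc b)) (sym (ℕ.+-suc a m)) ⟩
  sgn a · h a ⊕ sgn (a + suc m) · h (suc (a + suc m)) ∎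
  where
  open SetoidReasoning ≋-setoid
  last : Lin
  last = sgn (suc a + m) · h (suc (suc a + m))

-- Up to the sign (-1)^{k+1}, the antipode identity Σ S(u) ⧢ v = 0 of the shuffle Hopf algebra,
-- summed over the deconcatenations u v of the word (k+2) ⋯ N.  It telescopes: the i-th term is
-- h i ⊕ h (i+1) with h i = i (δ_{i-1,k+2} ⧢ η_{i+1,N}), and h (k+1) = h (N+1) = 0.
antipode : ∀ k m →
  alt (suc k) (suc (suc m)) (λ i → sh (δ i (suc (suc k))) (η (suc i) (suc (suc (m + k))))) ≋ []
antipode k m = ≋-trans (alt-telescope g h (suc k) (suc m) g≋h⊕h)
  (≡⇒≋ (cong₂ _⊕_ (cong (sgn (suc k) ·_) h-first)
                  (trans (cong (λ i → sgn i · h (suc i)) N≡) (cong (sgn N ·_) h-last))))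
  where
  b N : ℕ
  b = suc (suc k)
  N = suc (suc (m + k))
  N≡ : suc k + suc m ≡ N
  N≡ = trans (ℕ.+-comm (suc k) (suc m)) (cong suc (ℕ.+-suc m k))
  b≤N : b ≤ N
  b≤N = s≤s (s≤s (ℕ.m≤n+m k m))

  g h : ℕ → Lin
  g i = sh (δ i b) (η (suc i) N)
  h zero    = []
  h (suc j) = pre (suc j) (sh (δ j b) (η (suc (suc j)) N))

  h-first : h (suc k) ≡ []
  h-first = cong (λ z → pre (suc k) (sh z (η b N))) (δ-zero k)

  h-last : h (suc N) ≡ []
  h-last = trans (cong (λ z → pre (suc N) (sh (δ N b) z)) (η-zero N)) (cong (pre (suc N)) (bilin-[]ʳ shw (δ N b)))

  first : g (suc k) ≋ h (suc k) ⊕ h b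
  first = ≋-trans (sh-emptyˡ (δ-empty (suc k)) (η b N))
    (≋-trans (η-cons b N b≤N)
    (≋-sym (≋-trans (≡⇒≋ (cong (_⊕ h b) h-first)) (pre-cong b (sh-emptyˡ (δ-empty (suc k)) (η (suc b) N))))))

  middle : ∀ j → suc k ≤ j → suc (suc j) ≤ N → g (suc j) ≋ h (suc j) ⊕ h (suc (suc j))
  middle j k<j j<N = ≋-trans
    (≋-trans (bilin-congˡ shw (η (suc (suc j)) N) (δ-cons j b (s≤s k<j)))
             (bilin-congʳ shw (pre (suc j) (δ j b)) (η-cons (suc (suc j)) N j<N)))
    (≋-trans (sh-pre-pre (suc j) (suc (suc j)) (δ j b) (η (suc (suc (suc j))) N))
    (⊕-cong (pre-cong (suc j) (bilin-congʳ shw (δ j b) (≋-sym (η-cons (suc (suc j)) N j<N))))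
            (pre-cong (suc (suc j)) (bilin-congˡ shw (η (suc (suc (suc j))) N) (≋-sym (δ-cons j b (s≤s k<j)))))))

  final : g N ≋ h N ⊕ h (suc N)
  final = ≋-trans (sh-emptyʳ (δ N b) (η-empty N))
    (≋-trans (δ-cons (suc (m + k)) b b≤N)
    (≋-sym (≋-trans (≡⇒≋ (cong (h N ⊕_) h-last))
           (≋-trans (⊕-identityʳ (h N)) (pre-cong N (sh-emptyʳ (δ (suc (m + k)) b) (η-empty N)))))))

  g≋h⊕h : ∀ i → suc k ≤ i → i ≤ suc k + suc m → g i ≋ h i ⊕ h (suc i)
  g≋h⊕h i k<i i≤ with ℕ.m≤n⇒m<n∨m≡n k<i
  ... | inj₂ refl = first
  ... | inj₁ (s≤s {n = j} k<j) with ℕ.m≤n⇒m<n∨m≡n (subst (suc j ≤_) N≡ i≤)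
  ...   | inj₁ j<N = middle j k<j j<N
  ...   | inj₂ refl = final

shuffleδ : ℕ → Lin → ℕ → Lin
shuffleδ k X i = sh X (δ i (suc (suc k)))

summand : ℕ → ℕ → Lin → ℕ → ℕ → Lin
summand a k X n i = sh (post a (shuffleδ k X i)) (η (suc i) n)

module _ (a k : ℕ) (X : Lin) where

  -- The theorem with X for (k+1)η_{2,k-1}, the letter a for the final k, upper limit n,
  -- and m = n - k - 1 terms in the sum.
  ShuffleIdentity : ℕ → ℕ → Set
  ShuffleIdentity m n =
    sgn k · cat (post a X) (η (suc (suc k)) n) ⊕ alt (suc k) m (summand a k X n)
      ≋ sgn (suc n) · post a (shuffleδ k X n)

  shuffle-identity-base : ShuffleIdentity 0 (suc k)
  shuffle-identity-base = begin
    sgn k · cat (post a X) (η (suc (suc k)) (suc k)) ⊕ []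
      ≈⟨ ⊕-identityʳ _ ⟩
    sgn k · cat (post a X) (η (suc (suc k)) (suc k))
      ≈⟨ ·-cong (sgn k) (≋-trans (≡⇒≋ (cong (cat (post a X)) (η-empty (suc k))))
                                 (cat-identityʳ (post a X))) ⟩
    sgn k · post a X
      ≈⟨ ·-cong (sgn k) (post-cong a (≋-sym (sh-emptyʳ X (δ-empty (suc k))))) ⟩
    sgn k · post a (shuffleδ k X (suc k))
      ≡⟨ cong (_· post a (shuffleδ k X (suc k))) (sym (ℤ.neg-involutive (sgn k))) ⟩
    sgn (suc (suc k)) · post a (shuffleδ k X (suc k)) ∎
    where open SetoidReasoning ≋-setoid

  module Step (m : ℕ) where
    n N : ℕ
    n = suc (m + k)
    N = suc n

    W : ℕ → Lin
    W i = sh (shuffleδ k X i) (η (suc i) N)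

    first-term : cat (post a X) (η (suc (suc k)) N) ≋ post N (cat (post a X) (η (suc (suc k)) n))
    first-term = ≋-trans (bilin-congʳ catw (post a X) (η-snoc (suc (suc k)) n (s≤s (s≤s (ℕ.m≤n+m k m)))))
                         (cat-postʳ (post a X) N (η (suc (suc k)) n))

    summand-split : ∀ i → i ≤ n → summand a k X N i ≋ post a (W i) ⊕ post N (summand a k X n i)
    summand-split i i≤n = ≋-trans (bilin-congʳ shw (post a (shuffleδ k X i)) (η-snoc (suc i) n (s≤s i≤n)))
      (≋-trans (sh-post-post a N (shuffleδ k X i) (η (suc i) n))
               (⊕-congʳ (post-cong a (bilin-congʳ shw (shuffleδ k X i) (≋-sym (η-snoc (suc i) n (s≤s i≤n)))))))

    alt-split : alt (suc k) (suc m) (summand a k X N)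
                  ≋ post a (alt (suc k) (suc m) W) ⊕ post N (alt (suc k) (suc m) (summand a k X n))
    alt-split = ≋-trans
      (alt-cong (suc k) (suc m) λ i _ i<k+m → summand-split i (subst (i ≤_) k+m≡ (ℕ.≤-pred i<k+m)))
      (≋-trans (alt-⊕ (λ i → post a (W i)) (λ i → post N (summand a k X n i)) (suc k) (suc m))
               (⊕-cong (alt-lin _ W (suc k) (suc m)) (alt-lin _ (summand a k X n) (suc k) (suc m))))
      where
      k+m≡ : k + suc m ≡ n
      k+m≡ = trans (ℕ.+-suc k m) (cong suc (ℕ.+-comm k m))

    alt-last-summand : alt (suc k) (suc m) (summand a k X n)
                         ≋ alt (suc k) m (summand a k X n) ⊕ sgn n · post a (shuffleδ k X n)
    alt-last-summand = ≋-trans (alt-snoc (summand a k X n) (suc k) m)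
      (⊕-congˡ (≋-trans (≡⇒≋ (cong (λ i → sgn i · summand a k X n i) (cong suc (ℕ.+-comm k m))))
                        (·-cong (sgn n) (sh-emptyʳ (post a (shuffleδ k X n)) (η-empty n)))))

    alt-W : alt (suc k) (suc m) W ≋ sgn (suc N) · shuffleδ k X N
    alt-W = x⊕c·y≋[]⇒x≋-c·y (alt (suc k) (suc m) W) (sgn N) (shuffleδ k X N) (begin
      alt (suc k) (suc m) W ⊕ sgn N · shuffleδ k X N
        ≈⟨ ⊕-congˡ (·-cong (sgn N) (≋-sym (sh-emptyʳ (shuffleδ k X N) (η-empty N)))) ⟩
      alt (suc k) (suc m) W ⊕ sgn N · W N
        ≡⟨ cong (λ i → alt (suc k) (suc m) W ⊕ sgn i · W i) (sym N≡) ⟩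
      alt (suc k) (suc m) W ⊕ sgn (suc k + suc m) · W (suc k + suc m)
        ≈⟨ ≋-sym (alt-snoc W (suc k) (suc m)) ⟩
      alt (suc k) (suc (suc m)) W
        ≈⟨ alt-cong (suc k) (suc (suc m)) (λ i _ _ → sh-assoc X (δ i (suc (suc k))) (η (suc i) N)) ⟩
      alt (suc k) (suc (suc m)) (λ i → sh X (sh (δ i (suc (suc k))) (η (suc i) N)))
        ≈⟨ alt-sh X (λ i → sh (δ i (suc (suc k))) (η (suc i) N)) (suc k) (suc (suc m)) ⟩
      sh X (alt (suc k) (suc (suc m)) (λ i → sh (δ i (suc (suc k))) (η (suc i) N)))
        ≈⟨ bilin-congʳ shw X (antipode k m) ⟩
      sh X []
        ≡⟨ bilin-[]ʳ shw X ⟩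
      [] ∎)
      where
      open SetoidReasoning ≋-setoid
      N≡ : suc k + suc m ≡ N
      N≡ = trans (ℕ.+-comm (suc k) (suc m)) (cong suc (ℕ.+-suc m k))

    step : ShuffleIdentity m n → ShuffleIdentity (suc m) N
    step hyp = begin
      sgn k · cat (post a X) (η (suc (suc k)) N) ⊕ alt (suc k) (suc m) (summand a k X N)
        ≈⟨ ⊕-cong (·-cong (sgn k) first-term) (≋-trans alt-split (⊕-congˡ (post-cong N alt-last-summand))) ⟩
      sgn k · post N C ⊕ (post a AW ⊕ post N (S ⊕ sgn n · Y))
        ≈⟨ x∙yz≈y∙xz (sgn k · post N C) (post a AW) (post N (S ⊕ sgn n · Y)) ⟩
      post a AW ⊕ (sgn k · post N C ⊕ post N (S ⊕ sgn n · Y))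
        ≈⟨ ⊕-congˡ (≋-trans (⊕-congʳ (≋-sym (post-· N (sgn k) C)))
                             (≡⇒≋ (sym (mapW-⊕ _ (sgn k · C) (S ⊕ sgn n · Y))))) ⟩
      post a AW ⊕ post N (sgn k · C ⊕ (S ⊕ sgn n · Y))
        ≈⟨ ⊕-congˡ (post-cong N (≋-trans (≋-sym (⊕-assoc (sgn k · C) S (sgn n · Y))) (⊕-congʳ hyp))) ⟩
      post a AW ⊕ post N (sgn (suc n) · Y ⊕ sgn n · Y)
        ≈⟨ ⊕-congˡ (post-cong N (·-inverseˡ (sgn n) Y)) ⟩
      post a AW ⊕ []
        ≈⟨ ⊕-identityʳ (post a AW) ⟩
      post a AW
        ≈⟨ post-cong a alt-W ⟩
      post a (sgn (suc N) · shuffleδ k X N)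
        ≈⟨ post-· a (sgn (suc N)) (shuffleδ k X N) ⟩
      sgn (suc N) · post a (shuffleδ k X N) ∎
      where
      open SetoidReasoning ≋-setoid
      C AW S Y : Lin
      C  = cat (post a X) (η (suc (suc k)) n)
      AW = alt (suc k) (suc m) W
      S  = alt (suc k) m (summand a k X n)
      Y  = post a (shuffleδ k X n)

  shuffle-identity : ∀ m → ShuffleIdentity m (suc (m + k))
  shuffle-identity zero    = shuffle-identity-base
  shuffle-identity (suc m) = Step.step m (shuffle-identity m)

  shuffle-identity-≤ : ∀ n → k ≤ n → ShuffleIdentity (n ∸ k) (suc n)
  shuffle-identity-≤ n k≤n = subst (λ l → ShuffleIdentity (n ∸ k) (suc l)) (ℕ.m∸n+n≡m k≤n) (shuffle-identity (n ∸ k))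

lemma3p4 : (k n : ℕ) → 2 ≤ k → k ≤ n ∸ 1 →
    (sgn k · (ltr (suc k) ⋆ η 2 k ⋆ η (k + 2) n))
      ⊕ Σ[ suc k ⋯ n ∸ 1 ] (λ i →
          sgn i · (((ltr (suc k) ⋆ η 2 (k ∸ 1)) ⧢ δ i (k + 2)) ⋆ ltr k ⧢ η (suc i) n))
    ≈ sgn (suc n) · (((ltr (suc k) ⋆ η 2 (k ∸ 1)) ⧢ δ n (k + 2)) ⋆ ltr k)
lemma3p4 (suc k) zero (s≤s (s≤s _)) ()
lemma3p4 k@(suc k₁) (suc n) 2≤k k≤n rewrite ℕ.+-comm k₁ 2 = ≋⇒≈ (begin
  sgn k · (E ⋆ η b (suc n)) ⊕ alt (suc k) (n ∸ k) (λ i → ((X ⧢ δ i b) ⋆ ltr k) ⧢ η (suc i) (suc n))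
    ≈⟨ ⊕-cong (·-cong (sgn k) (≋-trans (⋆-≋-cat E (η b (suc n))) (bilin-congˡ catw (η b (suc n)) E≋post)))
              (alt-cong (suc k) (n ∸ k) (λ i _ _ → summand≋ i)) ⟩
  sgn k · cat (post k X) (η b (suc n)) ⊕ alt (suc k) (n ∸ k) (summand k k X (suc n))
    ≈⟨ shuffle-identity-≤ k k X n k≤n ⟩
  sgn (suc (suc n)) · post k (shuffleδ k X (suc n))
    ≈⟨ ·-cong (sgn (suc (suc n))) (≋-sym (⧢⋆ltr X (δ (suc n) b) k)) ⟩
  sgn (suc (suc n)) · ((X ⧢ δ (suc n) b) ⋆ ltr k) ∎)
  where
  open SetoidReasoning ≋-setoid
  b : ℕ
  b = suc (suc k)
  X E : Lin
  X = ltr (suc k) ⋆ η 2 k₁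
  E = ltr (suc k) ⋆ η 2 k
  E≋post : E ≋ post k X
  E≋post = ≋-trans (⋆-≋-cat (ltr (suc k)) (η 2 k))
    (≋-trans (bilin-congʳ catw (ltr (suc k)) (η-snoc 2 k₁ 2≤k))
    (≋-trans (cat-postʳ (ltr (suc k)) k (η 2 k₁)) (post-cong k (≋-sym (⋆-≋-cat (ltr (suc k)) (η 2 k₁))))))
  summand≋ : ∀ i → ((X ⧢ δ i b) ⋆ ltr k) ⧢ η (suc i) (suc n) ≋ summand k k X (suc n) i
  summand≋ i = ≋-trans (⧢-≋-sh ((X ⧢ δ i b) ⋆ ltr k) (η (suc i) (suc n)))
                       (bilin-congˡ shw (η (suc i) (suc n)) (⧢⋆ltr X (δ i b) k))
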